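{- Let $x\in\mathbb{C}$ and let $\sqrt{9x^2-1}$ denote a fixed complex square root of $9x^2-1$. Then for every integer $n\geq 0$, $$\sum_{k=0}^n \binom{n}{k}\bigl(12x\sqrt{9x^2-1}\bigr)^{n-k} B_{n-k}\,B^*_{2k}(x) = 6xn\bigl(C_{2n-2}(x) - \sqrt{9x^2-1}\,B^*_{2n-2}(x)\bigr).$$
   Context: The Bernoulli polynomials $B_n(x)$ are defined by $\sum_{n\ge0}B_n(x)\frac{z^n}{n!}=\frac{ze^{xz}}{e^z-1}$ ($|z|<2\pi$), and $B_n=B_n(0)$ are the Bernoulli numbers (so $B_1=-1/2$). The balancing polynomials are defined by $B^*_0(x)=0$, $B^*_1(x)=1$, $B^*_n(x)=6xB^*_{n-1}(x)-B^*_{n-2}(x)$ for $n\ge2$. The Lucas-balancing polynomials are defined by $C_0(x)=1$, $C_1(x)=3x$, $C_n(x)=6xC_{n-1}(x)-C_{n-2}(x)$ for $n\ge2$. For $n=0$ the right-hand side, which carries the factor $n$, is interpreted as $0$. -}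

module Defs where

open import Level using (Level; _⊔_)
open import Data.Nat as ℕ using (ℕ; zero; suc; _!)
open import Data.Nat.Properties using (_!≢0)
open import Data.List using (List; []; _∷_; zipWith; upTo; foldr)
import Data.Integer as ℤ
open import Data.Rational as ℚ using (ℚ)
open import Data.Rational.Properties using (+-*-rawRing)
open import Algebra.Bundles using (CommutativeRing)
open import Algebra.Morphism.Structures using (IsRingHomomorphism)

-- Bernoulli numbers, from the generating function z/(e^z - 1).
-- (e^z - 1)/z = Σ a_k z^k with a_k = 1/(k+1)!.  Its reciprocal
-- z/(e^z-1) = Σ b_n z^n has b_0 = 1, b_n = - Σ_{k=1}^n a_k b_{n-k},
-- and B_n = n! b_n.

expCoeff : ℕ → ℚ
expCoeff k = ℤ.+ 1 ℚ./ (suc k !)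
  where instance _ = (suc k) !≢0

-- bList n = [b_n , b_{n-1} , … , b_0]
bList : ℕ → List ℚ
bList zero = ℚ.1ℚ ∷ []
bList (suc n) =
  ℚ.- foldr ℚ._+_ ℚ.0ℚ
        (zipWith (λ k bv → expCoeff (suc k) ℚ.* bv) (upTo (suc n)) prev)
  ∷ prev
  where prev = bList n

headOr0 : List ℚ → ℚ
headOr0 [] = ℚ.0ℚ
headOr0 (q ∷ _) = q

-- Bernoulli numbers B_n (so B_1 = -1/2)
bernoulli : ℕ → ℚ
bernoulli n = (ℤ.+ (n !) ℚ./ 1) ℚ.* headOr0 (bList n)

record QAlgebra (c ℓ : Level) : Set (Level.suc (c ⊔ ℓ)) where
  field
    commRing : CommutativeRing c ℓ
  open CommutativeRing commRing public
  field
    ι : ℚ → Carrier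
    ι-hom : IsRingHomomorphism +-*-rawRing rawRing ι

module _ {c ℓ : Level} (A : QAlgebra c ℓ) where
  open QAlgebra A

  ιℕ : ℕ → Carrier
  ιℕ n = ι (ℤ.+ n ℚ./ 1)

  pow : Carrier → ℕ → Carrier
  pow y zero = 1#
  pow y (suc n) = y * pow y n

  sumTo : ℕ → (ℕ → Carrier) → Carrier
  sumTo zero f = f 0
  sumTo (suc n) f = sumTo n f + f (suc n)

  balancing : Carrier → ℕ → Carrier
  balancing x zero = 0#
  balancing x (suc zero) = 1#
  balancing x (suc (suc n)) = ιℕ 6 * x * balancing x (suc n) - balancing x n

  lucasBalancing : Carrier → ℕ → Carrier
  lucasBalancing x zero = 1#
  lucasBalancing x (suc zero) = ιℕ 3 * x
  lucasBalancing x (suc (suc n)) = ιℕ 6 * x * lucasBalancing x (suc n) - lucasBalancing x n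

-- Work with exponential generating functions: with β = 3x - s, v = β² and w = 12xs we have
-- (3x + s)² = v + w and (3x + s)β = 1, so B*_{2k} = 6x G_k where G_k is the k-th coefficient
-- of (e^{(v+w)z} - e^{vz})/w = ((e^{wz} - 1)/w) e^{vz}.  The left-hand side is the n-th coefficient
-- of (wz/(e^{wz} - 1)) · 6x G(z) = 6x z e^{vz}, namely 6x n v^{n-1} = 6x n β^{2n-2}, and
-- β^m = C_m - s B*_m.
module Submission where

open import Defs
open import Level using (Level)
open import Data.Nat as ℕ using (ℕ)
open import Data.Nat.Combinatorics using (_C_)

open import Data.Nat using (zero; suc; NonZero; _!; z≤n; s≤s)
open import Data.Product using (_×_; _,_; proj₁)
import Data.Nat.Properties as ℕP
open import Data.Nat.DivMod using (m/n*n≡m)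
import Data.Nat.Combinatorics as ℕC
import Data.Integer as ℤ
import Data.Integer.Properties as ℤP
open import Data.Rational as ℚ using (ℚ; 1ℚ; toℚᵘ)
open import Data.Rational.Properties
  using (toℚᵘ-injective; toℚᵘ-fromℚᵘ; toℚᵘ-homo-+; toℚᵘ-homo-*)
open import Data.Rational.Unnormalised as ℚᵘ using (mkℚᵘ; *≡*)
import Data.Rational.Unnormalised.Properties as ℚᵘP
open import Data.List using (zipWith; foldr; applyUpTo)
open import Data.Maybe using (Maybe; just; nothing)
open import Relation.Nullary using (yes; no)
open import Relation.Binary.PropositionalEquality as ≡ using (_≡_)
import Relation.Binary.Reasoning.Setoid as SetoidReasoning
open import Algebra.Solver.Ring.AlmostCommutativeRing
  using (fromCommutativeRing; _-Raw-AlmostCommutative⟶_)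
open import Algebra.Morphism.Structures using (module IsRingHomomorphism)
import Algebra.Properties.Ring as RingProperties
import Algebra.Properties.CommutativeSemigroup as CommutativeSemigroupProperties

fromℕ : ℕ → ℚ
fromℕ n = ℤ.+ n ℚ./ 1

toℚᵘ-fromℕ : ∀ n → toℚᵘ (fromℕ n) ℚᵘ.≃ mkℚᵘ (ℤ.+ n) 0
toℚᵘ-fromℕ n = toℚᵘ-fromℚᵘ (mkℚᵘ (ℤ.+ n) 0)

fromℕ-homo-+ : ∀ m n → fromℕ (m ℕ.+ n) ≡ fromℕ m ℚ.+ fromℕ n
fromℕ-homo-+ m n = toℚᵘ-injective (begin
  toℚᵘ (fromℕ (m ℕ.+ n))              ≈⟨ toℚᵘ-fromℕ (m ℕ.+ n) ⟩
  mkℚᵘ (ℤ.+ (m ℕ.+ n)) 0              ≈⟨ *≡* (≡.cong (ℤ._* ℤ.+ 1) (≡.sym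
                                              (≡.cong₂ ℤ._+_ (ℤP.*-identityʳ (ℤ.+ m)) (ℤP.*-identityʳ (ℤ.+ n))))) ⟩
  mkℚᵘ (ℤ.+ m) 0 ℚᵘ.+ mkℚᵘ (ℤ.+ n) 0  ≈⟨ ℚᵘP.+-cong (toℚᵘ-fromℕ m) (toℚᵘ-fromℕ n) ⟨
  toℚᵘ (fromℕ m) ℚᵘ.+ toℚᵘ (fromℕ n)  ≈⟨ toℚᵘ-homo-+ (fromℕ m) (fromℕ n) ⟨
  toℚᵘ (fromℕ m ℚ.+ fromℕ n)          ∎)
  where open ℚᵘP.≃-Reasoning

fromℕ-*-inverse : ∀ m .{{_ : NonZero m}} → fromℕ m ℚ.* (ℤ.+ 1 ℚ./ m) ≡ 1ℚ
fromℕ-*-inverse (suc j) = toℚᵘ-injective (begin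
  toℚᵘ (fromℕ (suc j) ℚ.* (ℤ.+ 1 ℚ./ suc j))          ≈⟨ toℚᵘ-homo-* (fromℕ (suc j)) (ℤ.+ 1 ℚ./ suc j) ⟩
  toℚᵘ (fromℕ (suc j)) ℚᵘ.* toℚᵘ (ℤ.+ 1 ℚ./ suc j)   ≈⟨ ℚᵘP.*-cong (toℚᵘ-fromℕ (suc j)) (toℚᵘ-fromℚᵘ (mkℚᵘ (ℤ.+ 1) j)) ⟩
  mkℚᵘ (ℤ.+ suc j) 0 ℚᵘ.* mkℚᵘ (ℤ.+ 1) j              ≈⟨ ℚᵘP.*-inverseʳ (mkℚᵘ (ℤ.+ suc j) 0) ⟩
  toℚᵘ 1ℚ                                             ∎)
  where open ℚᵘP.≃-Reasoning

nCk*[k!*[n∸k]!]≡n! : ∀ {n k} → k ℕ.≤ n → (n C k) ℕ.* (k ! ℕ.* (n ℕ.∸ k) !) ≡ n !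
nCk*[k!*[n∸k]!]≡n! {n} {k} k≤n =
  ≡.trans (≡.cong (ℕ._* (k ! ℕ.* (n ℕ.∸ k) !)) (ℕC.nCk≡n!/k![n-k]! k≤n)) (m/n*n≡m (ℕC.k![n∸k]!∣n! k≤n))
  where instance _ = ℕP._!*_!≢0 k (n ℕ.∸ k)

bernoulliCoeff : ℕ → ℚ
bernoulliCoeff n = headOr0 (bList n)

module Identities {c ℓ : Level} (A : QAlgebra c ℓ) where
  open QAlgebra A
  open IsRingHomomorphism ι-hom using (+-homo; *-homo; -‿homo; 0#-homo; 1#-homo)
  open RingProperties ring using (-0#≈0#)
  open CommutativeSemigroupProperties +-commutativeSemigroup using () renaming (interchange to +-interchange)
  open SetoidReasoning setoid

  private
    ι-morphism : ℚ.+-*-rawRing -Raw-AlmostCommutative⟶ fromCommutativeRing commRing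
    ι-morphism = record
      { ⟦_⟧ = ι ; +-homo = +-homo ; *-homo = *-homo ; -‿homo = -‿homo
      ; 0-homo = 0#-homo ; 1-homo = 1#-homo }

    ι-≟ : ∀ p q → Maybe (ι p ≈ ι q)
    ι-≟ p q with p ℚ.≟ q
    ... | yes ≡.refl = just refl
    ... | no _ = nothing

  open import Algebra.Solver.Ring ℚ.+-*-rawRing (fromCommutativeRing commRing) ι-morphism ι-≟
    using (solve; _:+_; _:-_; _:*_; :-_; _:=_; con; Polynomial)

  private
    ⌜_⌝ : ∀ {m} → ℕ → Polynomial m
    ⌜ n ⌝ = con (fromℕ n)

  ιℕ-0 : ιℕ A 0 ≈ 0#
  ιℕ-0 = 0#-homo

  ιℕ-1 : ιℕ A 1 ≈ 1#
  ιℕ-1 = 1#-homo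

  ιℕ-homo-+ : ∀ m n → ιℕ A (m ℕ.+ n) ≈ ιℕ A m + ιℕ A n
  ιℕ-homo-+ m n = trans (reflexive (≡.cong ι (fromℕ-homo-+ m n))) (+-homo (fromℕ m) (fromℕ n))

  ιℕ-homo-* : ∀ m n → ιℕ A (m ℕ.* n) ≈ ιℕ A m * ιℕ A n
  ιℕ-homo-* zero n = trans ιℕ-0 (trans (sym (zeroˡ (ιℕ A n))) (*-cong (sym ιℕ-0) refl))
  ιℕ-homo-* (suc m) n = begin
    ιℕ A (n ℕ.+ m ℕ.* n)          ≈⟨ ιℕ-homo-+ n (m ℕ.* n) ⟩
    ιℕ A n + ιℕ A (m ℕ.* n)       ≈⟨ +-cong refl (ιℕ-homo-* m n) ⟩
    ιℕ A n + ιℕ A m * ιℕ A n      ≈⟨ solve 2 (λ a b → a :+ b :* a := (con 1ℚ :+ b) :* a) refl (ιℕ A n) (ιℕ A m) ⟩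
    (ι 1ℚ + ιℕ A m) * ιℕ A n      ≈⟨ *-cong (sym (ιℕ-homo-+ 1 m)) refl ⟩
    ιℕ A (suc m) * ιℕ A n         ∎

  ιℕ-*-inverse : ∀ m .{{_ : NonZero m}} → ιℕ A m * ι (ℤ.+ 1 ℚ./ m) ≈ 1#
  ιℕ-*-inverse m = trans (sym (*-homo (fromℕ m) (ℤ.+ 1 ℚ./ m)))
                         (trans (reflexive (≡.cong ι (fromℕ-*-inverse m))) 1#-homo)

  pow-cong : ∀ {a b} n → a ≈ b → pow A a n ≈ pow A b n
  pow-cong zero a≈b = refl
  pow-cong (suc n) a≈b = *-cong a≈b (pow-cong n a≈b)

  pow-homo-+ : ∀ a m n → pow A a m * pow A a n ≈ pow A a (m ℕ.+ n)
  pow-homo-+ a zero n = *-identityˡ _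
  pow-homo-+ a (suc m) n = trans (*-assoc _ _ _) (*-cong refl (pow-homo-+ a m n))

  pow-double : ∀ a n → pow A a (2 ℕ.* n) ≈ pow A (a * a) n
  pow-double a zero = refl
  pow-double a (suc n) = begin
    pow A a (2 ℕ.* suc n)              ≈⟨ reflexive (≡.cong (pow A a) (ℕP.*-suc 2 n)) ⟩
    a * (a * pow A a (2 ℕ.* n))        ≈⟨ *-assoc a a _ ⟨
    a * a * pow A a (2 ℕ.* n)          ≈⟨ *-cong refl (pow-double a n) ⟩
    a * a * pow A (a * a) n            ∎

  sumTo-cong≤ : ∀ n {f g : ℕ → Carrier} → (∀ k → k ℕ.≤ n → f k ≈ g k) → sumTo A n f ≈ sumTo A n g
  sumTo-cong≤ zero f≈g = f≈g 0 z≤n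
  sumTo-cong≤ (suc n) f≈g =
    +-cong (sumTo-cong≤ n (λ k k≤n → f≈g k (ℕP.m≤n⇒m≤1+n k≤n))) (f≈g (suc n) ℕP.≤-refl)

  sumTo-cong : ∀ n {f g : ℕ → Carrier} → (∀ k → f k ≈ g k) → sumTo A n f ≈ sumTo A n g
  sumTo-cong n f≈g = sumTo-cong≤ n (λ k _ → f≈g k)

  sumTo-suc : ∀ n (f : ℕ → Carrier) → sumTo A (suc n) f ≈ f 0 + sumTo A n (λ k → f (suc k))
  sumTo-suc zero f = refl
  sumTo-suc (suc n) f = trans (+-cong (sumTo-suc n f) refl) (+-assoc _ _ _)

  sumTo-+ : ∀ n (f g : ℕ → Carrier) → sumTo A n (λ k → f k + g k) ≈ sumTo A n f + sumTo A n g
  sumTo-+ zero f g = refl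
  sumTo-+ (suc n) f g = trans (+-cong (sumTo-+ n f g) refl)
    (+-interchange _ _ _ _)

  sumTo-*ˡ : ∀ n a (f : ℕ → Carrier) → sumTo A n (λ k → a * f k) ≈ a * sumTo A n f
  sumTo-*ˡ zero a f = refl
  sumTo-*ˡ (suc n) a f = trans (+-cong (sumTo-*ˡ n a f) refl) (sym (distribˡ a _ _))

  shift : (ℕ → Carrier) → ℕ → Carrier
  shift f k = f (suc k)

  -- The coefficients of the product of the exponential generating functions Σ f k zᵏ/k! and
  -- Σ g k zᵏ/k!, defined through the Leibniz rule D(fg) = (Df)g + f(Dg) for D = shift.
  infixl 7 _⊛_
  _⊛_ : (ℕ → Carrier) → (ℕ → Carrier) → ℕ → Carrier
  (f ⊛ g) zero = f 0 * g 0
  (f ⊛ g) (suc n) = (shift f ⊛ g) n + (f ⊛ shift g) n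

  ⊛-cong : ∀ {f f′ g g′} → (∀ k → f k ≈ f′ k) → (∀ k → g k ≈ g′ k) → ∀ n → (f ⊛ g) n ≈ (f′ ⊛ g′) n
  ⊛-cong f≈f′ g≈g′ zero = *-cong (f≈f′ 0) (g≈g′ 0)
  ⊛-cong f≈f′ g≈g′ (suc n) =
    +-cong (⊛-cong (λ k → f≈f′ (suc k)) g≈g′ n) (⊛-cong f≈f′ (λ k → g≈g′ (suc k)) n)

  ⊛-distribˡ-+ : ∀ f g h n → (f ⊛ (λ k → g k + h k)) n ≈ (f ⊛ g) n + (f ⊛ h) n
  ⊛-distribˡ-+ f g h zero = distribˡ (f 0) (g 0) (h 0)
  ⊛-distribˡ-+ f g h (suc n) =
    trans (+-cong (⊛-distribˡ-+ (shift f) g h n) (⊛-distribˡ-+ f (shift g) (shift h) n))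
          (+-interchange _ _ _ _)

  ⊛-distribʳ-+ : ∀ f g h n → ((λ k → f k + g k) ⊛ h) n ≈ (f ⊛ h) n + (g ⊛ h) n
  ⊛-distribʳ-+ f g h zero = distribʳ (h 0) (f 0) (g 0)
  ⊛-distribʳ-+ f g h (suc n) =
    trans (+-cong (⊛-distribʳ-+ (shift f) (shift g) h n) (⊛-distribʳ-+ f g (shift h) n))
          (+-interchange _ _ _ _)

  ⊛-*ˡ : ∀ a f g n → ((λ k → a * f k) ⊛ g) n ≈ a * (f ⊛ g) n
  ⊛-*ˡ a f g zero = *-assoc a (f 0) (g 0)
  ⊛-*ˡ a f g (suc n) = trans (+-cong (⊛-*ˡ a (shift f) g n) (⊛-*ˡ a f (shift g) n)) (sym (distribˡ a _ _))

  ⊛-*ʳ : ∀ a f g n → (f ⊛ (λ k → a * g k)) n ≈ a * (f ⊛ g) n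
  ⊛-*ʳ a f g zero = solve 3 (λ a b c → b :* (a :* c) := a :* (b :* c)) refl a (f 0) (g 0)
  ⊛-*ʳ a f g (suc n) = trans (+-cong (⊛-*ʳ a (shift f) g n) (⊛-*ʳ a f (shift g) n)) (sym (distribˡ a _ _))

  ⊛-assoc : ∀ f g h n → (f ⊛ (g ⊛ h)) n ≈ ((f ⊛ g) ⊛ h) n
  ⊛-assoc f g h zero = sym (*-assoc (f 0) (g 0) (h 0))
  ⊛-assoc f g h (suc n) = begin
    (shift f ⊛ (g ⊛ h)) n + (f ⊛ (λ k → (shift g ⊛ h) k + (g ⊛ shift h) k)) n
      ≈⟨ +-cong (⊛-assoc (shift f) g h n) (⊛-distribˡ-+ f _ _ n) ⟩
    ((shift f ⊛ g) ⊛ h) n + ((f ⊛ (shift g ⊛ h)) n + (f ⊛ (g ⊛ shift h)) n)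
      ≈⟨ +-cong refl (+-cong (⊛-assoc f (shift g) h n) (⊛-assoc f g (shift h) n)) ⟩
    ((shift f ⊛ g) ⊛ h) n + (((f ⊛ shift g) ⊛ h) n + ((f ⊛ g) ⊛ shift h) n)
      ≈⟨ +-assoc _ _ _ ⟨
    ((shift f ⊛ g) ⊛ h) n + ((f ⊛ shift g) ⊛ h) n + ((f ⊛ g) ⊛ shift h) n
      ≈⟨ +-cong (⊛-distribʳ-+ (shift f ⊛ g) (f ⊛ shift g) h n) refl ⟨
    ((λ k → (shift f ⊛ g) k + (f ⊛ shift g) k) ⊛ h) n + ((f ⊛ g) ⊛ shift h) n
      ∎

  binomialSum : (ℕ → Carrier) → (ℕ → Carrier) → ℕ → Carrier
  binomialSum f g n = sumTo A n (λ k → ιℕ A (n C k) * f (n ℕ.∸ k) * g k)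

  binomialSum-suc : ∀ f g n →
    binomialSum f g (suc n) ≈ binomialSum (shift f) g n + binomialSum f (shift g) n
  binomialSum-suc f g n = begin
    sumTo A (suc n) T                                    ≈⟨ sumTo-suc n T ⟩
    T 0 + sumTo A n (shift T)                            ≈⟨ +-cong refl (sumTo-cong n pascal) ⟩
    F 0 + sumTo A n (λ k → Y k + F (suc k))              ≈⟨ +-cong refl (sumTo-+ n Y (shift F)) ⟩
    F 0 + (sumTo A n Y + sumTo A n (shift F))            ≈⟨ solve 3 (λ a b c → a :+ (b :+ c) := (a :+ c) :+ b) refl _ _ _ ⟩
    F 0 + sumTo A n (shift F) + sumTo A n Y              ≈⟨ +-cong (sumTo-suc n F) refl ⟨
    sumTo A n F + F (suc n) + sumTo A n Y                ≈⟨ +-cong (trans (+-cong refl last-vanishes) (+-identityʳ _)) refl ⟩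
    sumTo A n F + sumTo A n Y                            ≈⟨ +-cong (sumTo-cong≤ n reindex) refl ⟩
    binomialSum (shift f) g n + binomialSum f (shift g) n ∎
    where
    T F Y : ℕ → Carrier
    T k = ιℕ A (suc n C k) * f (suc n ℕ.∸ k) * g k
    F k = ιℕ A (n C k) * f (suc n ℕ.∸ k) * g k
    Y k = ιℕ A (n C k) * f (n ℕ.∸ k) * g (suc k)

    pascal : ∀ k → T (suc k) ≈ Y k + F (suc k)
    pascal k = begin
      ιℕ A (suc n C suc k) * f (n ℕ.∸ k) * g (suc k)
        ≈⟨ *-cong (*-cong (reflexive (≡.cong (ιℕ A) (≡.sym (ℕC.nCk+nC[k+1]≡[n+1]C[k+1] n k)))) refl) refl ⟩
      ιℕ A (n C k ℕ.+ n C suc k) * f (n ℕ.∸ k) * g (suc k)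
        ≈⟨ *-cong (*-cong (ιℕ-homo-+ (n C k) (n C suc k)) refl) refl ⟩
      (ιℕ A (n C k) + ιℕ A (n C suc k)) * f (n ℕ.∸ k) * g (suc k)
        ≈⟨ solve 4 (λ a b x y → (a :+ b) :* x :* y := a :* x :* y :+ b :* x :* y) refl _ _ _ _ ⟩
      Y k + F (suc k) ∎

    last-vanishes : F (suc n) ≈ 0#
    last-vanishes = begin
      ιℕ A (n C suc n) * f (n ℕ.∸ n) * g (suc n) ≈⟨ *-cong (*-cong (reflexive (≡.cong (ιℕ A) (ℕC.k>n⇒nCk≡0 (ℕP.n<1+n n)))) refl) refl ⟩
      ιℕ A 0 * f (n ℕ.∸ n) * g (suc n)   ≈⟨ trans (*-cong (trans (*-cong ιℕ-0 refl) (zeroˡ _)) refl) (zeroˡ _) ⟩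
      0#                                 ∎

    reindex : ∀ k → k ℕ.≤ n → F k ≈ ιℕ A (n C k) * shift f (n ℕ.∸ k) * g k
    reindex k k≤n = *-cong (*-cong refl (reflexive (≡.cong f (ℕP.+-∸-assoc 1 k≤n)))) refl

  ⊛-binomial : ∀ f g n → (f ⊛ g) n ≈ binomialSum f g n
  ⊛-binomial f g zero = solve 2 (λ a b → a :* b := con 1ℚ :* a :* b) refl (f 0) (g 0)
  ⊛-binomial f g (suc n) =
    trans (+-cong (⊛-binomial (shift f) g n) (⊛-binomial f (shift g) n)) (sym (binomialSum-suc f g n))

  pow⊛pow : ∀ a b n → (pow A a ⊛ pow A b) n ≈ pow A (a + b) n
  pow⊛pow a b zero = *-identityˡ 1#
  pow⊛pow a b (suc n) = begin
    ((λ k → a * pow A a k) ⊛ pow A b) n + (pow A a ⊛ (λ k → b * pow A b k)) n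
      ≈⟨ +-cong (⊛-*ˡ a (pow A a) (pow A b) n) (⊛-*ʳ b (pow A a) (pow A b) n) ⟩
    a * (pow A a ⊛ pow A b) n + b * (pow A a ⊛ pow A b) n ≈⟨ distribʳ _ a b ⟨
    (a + b) * (pow A a ⊛ pow A b) n                       ≈⟨ *-cong refl (pow⊛pow a b n) ⟩
    (a + b) * pow A (a + b) n                             ∎

  δ₀ : ℕ → Carrier
  δ₀ zero = 1#
  δ₀ (suc _) = 0#

  δ₁ : ℕ → Carrier
  δ₁ zero = 0#
  δ₁ (suc k) = δ₀ k

  *δ₀≈δ₀ : ∀ (f : ℕ → Carrier) → f 0 ≈ 1# → ∀ n → f n * δ₀ n ≈ δ₀ n
  *δ₀≈δ₀ f f0≈1 zero = trans (*-cong f0≈1 refl) (*-identityˡ 1#)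
  *δ₀≈δ₀ f f0≈1 (suc n) = zeroʳ (f (suc n))

  0⊛ : ∀ g n → ((λ _ → 0#) ⊛ g) n ≈ 0#
  0⊛ g zero = zeroˡ (g 0)
  0⊛ g (suc n) = trans (+-cong (0⊛ g n) (0⊛ (shift g) n)) (+-identityˡ 0#)

  δ₀⊛ : ∀ g n → (δ₀ ⊛ g) n ≈ g n
  δ₀⊛ g zero = *-identityˡ (g 0)
  δ₀⊛ g (suc n) = trans (+-cong (0⊛ g n) (δ₀⊛ (shift g) n)) (+-identityˡ _)

  δ₁⊛pow : ∀ v n → (δ₁ ⊛ pow A v) n ≈ ιℕ A n * pow A v (n ℕ.∸ 1)
  δ₁⊛pow v zero = trans (zeroˡ 1#) (sym (trans (*-cong ιℕ-0 refl) (zeroˡ 1#)))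
  δ₁⊛pow v (suc n) = begin
    (δ₀ ⊛ pow A v) n + (δ₁ ⊛ (λ k → v * pow A v k)) n ≈⟨ +-cong (δ₀⊛ (pow A v) n) (⊛-*ʳ v δ₁ (pow A v) n) ⟩
    pow A v n + v * (δ₁ ⊛ pow A v) n                  ≈⟨ +-cong refl (*-cong refl (δ₁⊛pow v n)) ⟩
    pow A v n + v * (ιℕ A n * pow A v (n ℕ.∸ 1))      ≈⟨ +-cong refl (*-pow-pred n) ⟩
    pow A v n + ιℕ A n * pow A v n                    ≈⟨ solve 2 (λ p m → p :+ m :* p := (con 1ℚ :+ m) :* p) refl _ _ ⟩
    (ι 1ℚ + ιℕ A n) * pow A v n                       ≈⟨ *-cong (ιℕ-homo-+ 1 n) refl ⟨
    ιℕ A (suc n) * pow A v n                          ∎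
    where
    *-pow-pred : ∀ m → v * (ιℕ A m * pow A v (m ℕ.∸ 1)) ≈ ιℕ A m * pow A v m
    *-pow-pred zero = trans (*-cong refl (trans (*-cong ιℕ-0 refl) (zeroˡ 1#)))
                            (trans (zeroʳ v) (sym (trans (*-cong ιℕ-0 refl) (zeroˡ 1#))))
    *-pow-pred (suc m) = solve 3 (λ v a p → v :* (a :* p) := a :* (v :* p)) refl v _ _

  ι-foldr-zipWith-bList : ∀ m (g : ℕ → ℕ) (F : ℕ → ℚ → ℚ) →
    ι (foldr ℚ._+_ ℚ.0ℚ (zipWith F (applyUpTo g (suc m)) (bList m)))
      ≈ sumTo A m (λ k → ι (F (g k) (bernoulliCoeff (m ℕ.∸ k))))
  ι-foldr-zipWith-bList zero g F = trans (+-homo _ _) (trans (+-cong refl 0#-homo) (+-identityʳ _))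
  ι-foldr-zipWith-bList (suc m) g F =
    trans (+-homo _ _) (trans (+-cong refl (ι-foldr-zipWith-bList m (λ k → g (suc k)) F)) (sym (sumTo-suc m _)))

  ι-bernoulliCoeff-suc : ∀ m →
    ι (bernoulliCoeff (suc m)) ≈ - sumTo A m (λ k → ι (expCoeff (suc k)) * ι (bernoulliCoeff (m ℕ.∸ k)))
  ι-bernoulliCoeff-suc m = trans (-‿homo _) (-‿cong
    (trans (ι-foldr-zipWith-bList m (λ k → k) (λ k b → expCoeff (suc k) ℚ.* b)) (sumTo-cong m (λ k → *-homo _ _))))

  -- The product of (e^z - 1)/z and z/(e^z - 1) is 1.
  expCoeff⋆bernoulliCoeff : ∀ n → sumTo A n (λ k → ι (expCoeff k) * ι (bernoulliCoeff (n ℕ.∸ k))) ≈ δ₀ n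
  expCoeff⋆bernoulliCoeff zero = trans (*-cong 1#-homo 1#-homo) (*-identityˡ 1#)
  expCoeff⋆bernoulliCoeff (suc m) = begin
    sumTo A (suc m) (λ k → ι (expCoeff k) * ι (bernoulliCoeff (suc m ℕ.∸ k))) ≈⟨ sumTo-suc m _ ⟩
    ι (expCoeff 0) * ι (bernoulliCoeff (suc m)) + X       ≈⟨ +-cong (*-cong refl (ι-bernoulliCoeff-suc m)) refl ⟩
    ι 1ℚ * (- X) + X                                      ≈⟨ solve 1 (λ x → con 1ℚ :* (:- x) :+ x := con ℚ.0ℚ) refl X ⟩
    ι ℚ.0ℚ                                                ≈⟨ 0#-homo ⟩
    0#                                                    ∎
    where
    X : Carrier
    X = sumTo A m (λ k → ι (expCoeff (suc k)) * ι (bernoulliCoeff (m ℕ.∸ k)))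

  bernoulli-recurrence : ∀ n → sumTo A n (λ k → ιℕ A (suc n C suc k) * ι (bernoulli (n ℕ.∸ k))) ≈ δ₀ n
  bernoulli-recurrence n = begin
    sumTo A n (λ k → ιℕ A (suc n C suc k) * ι (bernoulli (n ℕ.∸ k)))
      ≈⟨ sumTo-cong≤ n term ⟩
    sumTo A n (λ k → ιℕ A (suc n !) * (ι (expCoeff k) * ι (bernoulliCoeff (n ℕ.∸ k))))
      ≈⟨ sumTo-*ˡ n (ιℕ A (suc n !)) _ ⟩
    ιℕ A (suc n !) * sumTo A n (λ k → ι (expCoeff k) * ι (bernoulliCoeff (n ℕ.∸ k)))
      ≈⟨ *-cong refl (expCoeff⋆bernoulliCoeff n) ⟩
    ιℕ A (suc n !) * δ₀ n
      ≈⟨ *δ₀≈δ₀ (λ m → ιℕ A (suc m !)) ιℕ-1 n ⟩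
    δ₀ n ∎
    where
    term : ∀ k → k ℕ.≤ n →
      ιℕ A (suc n C suc k) * ι (bernoulli (n ℕ.∸ k)) ≈ ιℕ A (suc n !) * (ι (expCoeff k) * ι (bernoulliCoeff (n ℕ.∸ k)))
    term k k≤n = begin
      binom * ι (bernoulli (n ℕ.∸ k))     ≈⟨ *-cong refl (*-homo _ _) ⟩
      binom * (j! * b)                    ≈⟨ *-identityʳ _ ⟨
      binom * (j! * b) * 1#               ≈⟨ *-cong refl (ιℕ-*-inverse (suc k !) {{ℕP._!≢0 (suc k)}}) ⟨
      binom * (j! * b) * ([k+1]! * a)     ≈⟨ solve 5 (λ c j b f a → c :* (j :* b) :* (f :* a) := c :* (f :* j) :* (a :* b)) refl binom j! b [k+1]! a ⟩
      binom * ([k+1]! * j!) * (a * b)     ≈⟨ *-cong binom*[k+1]!*j!≈[n+1]! refl ⟩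
      ιℕ A (suc n !) * (a * b)        ∎
      where
      binom j! b [k+1]! a : Carrier
      binom = ιℕ A (suc n C suc k)
      j! = ιℕ A ((n ℕ.∸ k) !)
      b = ι (bernoulliCoeff (n ℕ.∸ k))
      [k+1]! = ιℕ A (suc k !)
      a = ι (expCoeff k)

      binom*[k+1]!*j!≈[n+1]! : binom * ([k+1]! * j!) ≈ ιℕ A (suc n !)
      binom*[k+1]!*j!≈[n+1]! = begin
        binom * ([k+1]! * j!)                                    ≈⟨ *-cong refl (ιℕ-homo-* (suc k !) ((n ℕ.∸ k) !)) ⟨
        binom * ιℕ A (suc k ! ℕ.* (n ℕ.∸ k) !)                   ≈⟨ ιℕ-homo-* (suc n C suc k) _ ⟨
        ιℕ A ((suc n C suc k) ℕ.* (suc k ! ℕ.* (n ℕ.∸ k) !)) ≈⟨ reflexive (≡.cong (ιℕ A) (nCk*[k!*[n∸k]!]≡n! (s≤s k≤n))) ⟩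
        ιℕ A (suc n !)                                       ∎

  -- Coefficients of the exponential generating functions wz/(e^{wz} - 1) and (e^{wz} - 1)/w.
  scaledBernoulli : Carrier → ℕ → Carrier
  scaledBernoulli w j = pow A w j * ι (bernoulli j)

  scaledExpm1 : Carrier → ℕ → Carrier
  scaledExpm1 w zero = 0#
  scaledExpm1 w (suc j) = pow A w j

  scaledBernoulli⊛scaledExpm1 : ∀ w n → (scaledBernoulli w ⊛ scaledExpm1 w) n ≈ δ₁ n
  scaledBernoulli⊛scaledExpm1 w zero = zeroʳ _
  scaledBernoulli⊛scaledExpm1 w (suc n) = begin
    (scaledBernoulli w ⊛ scaledExpm1 w) (suc n)
      ≈⟨ ⊛-binomial (scaledBernoulli w) (scaledExpm1 w) (suc n) ⟩
    binomialSum (scaledBernoulli w) (scaledExpm1 w) (suc n)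
      ≈⟨ sumTo-suc n _ ⟩
    ιℕ A 1 * scaledBernoulli w (suc n) * 0# + sumTo A n (λ k → ιℕ A (suc n C suc k) * scaledBernoulli w (n ℕ.∸ k) * pow A w k)
      ≈⟨ +-cong (zeroʳ _) (sumTo-cong≤ n term) ⟩
    0# + sumTo A n (λ k → pow A w n * (ιℕ A (suc n C suc k) * ι (bernoulli (n ℕ.∸ k))))
      ≈⟨ trans (+-identityˡ _) (sumTo-*ˡ n (pow A w n) _) ⟩
    pow A w n * sumTo A n (λ k → ιℕ A (suc n C suc k) * ι (bernoulli (n ℕ.∸ k)))
      ≈⟨ *-cong refl (bernoulli-recurrence n) ⟩
    pow A w n * δ₀ n
      ≈⟨ *δ₀≈δ₀ (pow A w) refl n ⟩
    δ₀ n ∎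
    where
    term : ∀ k → k ℕ.≤ n → ιℕ A (suc n C suc k) * scaledBernoulli w (n ℕ.∸ k) * pow A w k
                           ≈ pow A w n * (ιℕ A (suc n C suc k) * ι (bernoulli (n ℕ.∸ k)))
    term k k≤n = trans (solve 4 (λ c p b r → c :* (p :* b) :* r := (p :* r) :* (c :* b)) refl _ _ _ _)
      (*-cong (trans (pow-homo-+ w (n ℕ.∸ k) k) (reflexive (≡.cong (pow A w) (ℕP.m∸n+n≡m k≤n)))) refl)

  recurrence₂-unique : ∀ (K : Carrier) {f g : ℕ → Carrier} → f 0 ≈ g 0 → f 1 ≈ g 1 →
    (∀ k → f (suc (suc k)) ≈ K * f (suc k) - f k) →
    (∀ k → g (suc (suc k)) ≈ K * g (suc k) - g k) →
    ∀ k → f k ≈ g k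
  recurrence₂-unique K {f} {g} f0≈g0 f1≈g1 f-rec g-rec k = proj₁ (consecutive k)
    where
    consecutive : ∀ k → f k ≈ g k × f (suc k) ≈ g (suc k)
    consecutive zero = f0≈g0 , f1≈g1
    consecutive (suc k) with consecutive k
    ... | fk≈gk , fk+1≈gk+1 =
      fk+1≈gk+1 , trans (f-rec k) (trans (+-cong (*-cong refl fk+1≈gk+1) (-‿cong fk≈gk)) (sym (g-rec k)))

  balancing-suc⁴ : ∀ x m → balancing A x (suc (suc (suc (suc m))))
                          ≈ (ιℕ A 36 * (x * x) - ιℕ A 2) * balancing A x (suc (suc m)) - balancing A x m
  balancing-suc⁴ x m = solve 3 (λ x b₀ b₁ →
    ⌜ 6 ⌝ :* x :* (⌜ 6 ⌝ :* x :* (⌜ 6 ⌝ :* x :* b₁ :- b₀) :- b₁) :- (⌜ 6 ⌝ :* x :* b₁ :- b₀)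
      := (⌜ 36 ⌝ :* (x :* x) :- ⌜ 2 ⌝) :* (⌜ 6 ⌝ :* x :* b₁ :- b₀) :- b₀)
    refl x (balancing A x m) (balancing A x (suc m))

  module Balancing (x s : Carrier) (s²≈9x²-1 : s * s ≈ ιℕ A 9 * (x * x) - 1#) where

    -- β and α = 3x + s are the roots of t² - 6xt + 1.
    β α v w K : Carrier
    β = ιℕ A 3 * x - s
    α = ιℕ A 6 * x - β
    v = β * β
    w = ιℕ A 12 * x * s
    K = ιℕ A 36 * (x * x) - ιℕ A 2

    β*β≈6xβ-1 : β * β ≈ ιℕ A 6 * x * β - 1#
    β*β≈6xβ-1 = begin
      β * β
        ≈⟨ solve 2 (λ x s → (⌜ 3 ⌝ :* x :- s) :* (⌜ 3 ⌝ :* x :- s)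
                        := ⌜ 6 ⌝ :* x :* (⌜ 3 ⌝ :* x :- s) :- ⌜ 9 ⌝ :* (x :* x) :+ s :* s) refl x s ⟩
      ιℕ A 6 * x * β - ιℕ A 9 * (x * x) + s * s                     ≈⟨ +-cong refl s²≈9x²-1 ⟩
      ιℕ A 6 * x * β - ιℕ A 9 * (x * x) + (ιℕ A 9 * (x * x) - 1#)
        ≈⟨ solve 3 (λ a t e → a :- t :+ (t :- e) := a :- e) refl _ _ 1# ⟩
      ιℕ A 6 * x * β - 1#                                           ∎

    α*β≈1 : α * β ≈ 1#
    α*β≈1 = begin
      α * β                                   ≈⟨ solve 2 (λ a b → (a :- b) :* b := a :* b :- b :* b) refl (ιℕ A 6 * x) β ⟩
      ιℕ A 6 * x * β - β * β                  ≈⟨ +-cong refl (-‿cong β*β≈6xβ-1) ⟩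
      ιℕ A 6 * x * β - (ιℕ A 6 * x * β - 1#) ≈⟨ solve 2 (λ a e → a :- (a :- e) := e) refl _ 1# ⟩
      1#                                      ∎

    w+v≈α*α : w + v ≈ α * α
    w+v≈α*α = solve 2 (λ x s → ⌜ 12 ⌝ :* x :* s :+ (⌜ 3 ⌝ :* x :- s) :* (⌜ 3 ⌝ :* x :- s)
                             := (⌜ 6 ⌝ :* x :- (⌜ 3 ⌝ :* x :- s)) :* (⌜ 6 ⌝ :* x :- (⌜ 3 ⌝ :* x :- s))) refl x s

    α*α*v≈1 : α * α * v ≈ 1#
    α*α*v≈1 = begin
      α * α * (β * β)   ≈⟨ solve 2 (λ a b → a :* a :* (b :* b) := (a :* b) :* (a :* b)) refl α β ⟩
      α * β * (α * β)   ≈⟨ *-cong α*β≈1 α*β≈1 ⟩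
      1# * 1#           ≈⟨ *-identityˡ 1# ⟩
      1#                ∎

    α*α+v≈K : α * α + v ≈ K
    α*α+v≈K = begin
      α * α + β * β
        ≈⟨ solve 2 (λ x b → (⌜ 6 ⌝ :* x :- b) :* (⌜ 6 ⌝ :* x :- b) :+ b :* b
                        := ⌜ 36 ⌝ :* (x :* x) :- ⌜ 2 ⌝ :* ((⌜ 6 ⌝ :* x :- b) :* b)) refl x β ⟩
      ιℕ A 36 * (x * x) - ιℕ A 2 * (α * β)  ≈⟨ +-cong refl (-‿cong (trans (*-cong refl α*β≈1) (*-identityʳ _))) ⟩
      K                                     ∎

    -- G k is the k-th coefficient of ((e^{wz} - 1)/w) e^{vz} = (e^{α²z} - e^{vz})/w.
    G : ℕ → Carrier
    G = scaledExpm1 w ⊛ pow A v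

    G-suc : ∀ k → G (suc k) ≈ pow A (α * α) k + v * G k
    G-suc k = +-cong (trans (pow⊛pow w v k) (pow-cong k w+v≈α*α)) (⊛-*ʳ v (scaledExpm1 w) (pow A v) k)

    G-recurrence : ∀ k → G (suc (suc k)) ≈ K * G (suc k) - G k
    G-recurrence k = begin
      G (suc (suc k))                         ≈⟨ G-suc (suc k) ⟩
      u * p + v * G (suc k)                   ≈⟨ +-cong refl (*-cong refl (G-suc k)) ⟩
      u * p + v * (p + v * G k)
        ≈⟨ solve 4 (λ u v p g → u :* p :+ v :* (p :+ v :* g) := (u :+ v) :* (p :+ v :* g) :- u :* v :* g) refl u v p (G k) ⟩
      (u + v) * (p + v * G k) - u * v * G k
        ≈⟨ +-cong (*-cong α*α+v≈K (sym (G-suc k))) (-‿cong (trans (*-cong α*α*v≈1 refl) (*-identityˡ _))) ⟩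
      K * G (suc k) - G k ∎
      where
      u p : Carrier
      u = α * α
      p = pow A u k

    G-0 : G 0 ≈ 0#
    G-0 = zeroˡ 1#

    G-1 : G 1 ≈ 1#
    G-1 = trans (G-suc 0) (trans (+-cong refl (trans (*-cong refl G-0) (zeroʳ v))) (+-identityʳ 1#))

    balancing-even : ∀ k → balancing A x (2 ℕ.* k) ≈ ιℕ A 6 * x * G k
    balancing-even = recurrence₂-unique K balancing-0 balancing-2 balancing-rec 6xG-rec
      where
      balancing-0 : 0# ≈ ιℕ A 6 * x * G 0
      balancing-0 = sym (trans (*-cong refl G-0) (zeroʳ _))

      balancing-2 : ιℕ A 6 * x * 1# - 0# ≈ ιℕ A 6 * x * G 1
      balancing-2 = trans (+-cong refl -0#≈0#) (trans (+-identityʳ _) (*-cong refl (sym G-1)))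

      balancing-rec : ∀ k → balancing A x (2 ℕ.* suc (suc k))
                          ≈ K * balancing A x (2 ℕ.* suc k) - balancing A x (2 ℕ.* k)
      balancing-rec k = begin
        balancing A x (2 ℕ.* (2 ℕ.+ k))  ≈⟨ reflexive (≡.cong (balancing A x) (ℕP.*-distribˡ-+ 2 2 k)) ⟩
        balancing A x (4 ℕ.+ 2 ℕ.* k)    ≈⟨ balancing-suc⁴ x (2 ℕ.* k) ⟩
        K * balancing A x (2 ℕ.+ 2 ℕ.* k) - balancing A x (2 ℕ.* k)
          ≈⟨ +-cong (*-cong refl (reflexive (≡.cong (balancing A x) (≡.sym (ℕP.*-distribˡ-+ 2 1 k))))) refl ⟩
        K * balancing A x (2 ℕ.* (1 ℕ.+ k)) - balancing A x (2 ℕ.* k) ∎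

      6xG-rec : ∀ k → ιℕ A 6 * x * G (suc (suc k))
                    ≈ K * (ιℕ A 6 * x * G (suc k)) - ιℕ A 6 * x * G k
      6xG-rec k = trans (*-cong refl (G-recurrence k))
        (solve 4 (λ a K g₁ g₀ → a :* (K :* g₁ :- g₀) := K :* (a :* g₁) :- a :* g₀) refl (ιℕ A 6 * x) _ _ _)

    lucasBalancing-balancing≈pow-β : ∀ m → lucasBalancing A x m - s * balancing A x m ≈ pow A β m
    lucasBalancing-balancing≈pow-β = recurrence₂-unique (ιℕ A 6 * x) initial₀ initial₁ lucas-rec pow-rec
      where
      initial₀ : 1# - s * 0# ≈ 1#
      initial₀ = trans (+-cong refl (trans (-‿cong (zeroʳ s)) -0#≈0#)) (+-identityʳ 1#)

      initial₁ : ιℕ A 3 * x - s * 1# ≈ β * 1#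
      initial₁ = trans (+-cong refl (-‿cong (*-identityʳ s))) (sym (*-identityʳ β))

      lucas-rec : ∀ k → lucasBalancing A x (suc (suc k)) - s * balancing A x (suc (suc k))
                      ≈ ιℕ A 6 * x * (lucasBalancing A x (suc k) - s * balancing A x (suc k))
                        - (lucasBalancing A x k - s * balancing A x k)
      lucas-rec k = solve 6 (λ a s l₀ l₁ b₀ b₁ → a :* l₁ :- l₀ :- s :* (a :* b₁ :- b₀) := a :* (l₁ :- s :* b₁) :- (l₀ :- s :* b₀))
        refl (ιℕ A 6 * x) s (lucasBalancing A x k) (lucasBalancing A x (suc k)) (balancing A x k) (balancing A x (suc k))

      pow-rec : ∀ k → β * (β * pow A β k) ≈ ιℕ A 6 * x * (β * pow A β k) - pow A β k
      pow-rec k = begin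
        β * (β * pow A β k)                ≈⟨ *-assoc β β _ ⟨
        β * β * pow A β k                  ≈⟨ *-cong β*β≈6xβ-1 refl ⟩
        (ιℕ A 6 * x * β - 1#) * pow A β k  ≈⟨ solve 4 (λ a b e p → (a :* b :- e) :* p := a :* (b :* p) :- e :* p) refl (ιℕ A 6 * x) β 1# _ ⟩
        ιℕ A 6 * x * (β * pow A β k) - 1# * pow A β k ≈⟨ +-cong refl (-‿cong (*-identityˡ _)) ⟩
        ιℕ A 6 * x * (β * pow A β k) - pow A β k ∎

theorem2 : ∀ {c ℓ : Level} (A : QAlgebra c ℓ) →
  let open QAlgebra A in
  (x s : Carrier) → s * s ≈ ιℕ A 9 * (x * x) - 1# → (n : ℕ) →
  sumTo A n (λ k → ιℕ A (n C k) * pow A (ιℕ A 12 * x * s) (n ℕ.∸ k)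
                     * ι (bernoulli (n ℕ.∸ k)) * balancing A x (2 ℕ.* k))
    ≈ ιℕ A 6 * x * ιℕ A n
        * (lucasBalancing A x (2 ℕ.* n ℕ.∸ 2) - s * balancing A x (2 ℕ.* n ℕ.∸ 2))
theorem2 A x s s²≈9x²-1 n = begin
  sumTo A n (λ k → ιℕ A (n C k) * pow A w (n ℕ.∸ k) * ι (bernoulli (n ℕ.∸ k)) * balancing A x (2 ℕ.* k))
    ≈⟨ sumTo-cong n (λ k → *-cong (*-assoc _ _ _) (balancing-even k)) ⟩
  binomialSum (scaledBernoulli w) (λ k → 6x * G k) n        ≈⟨ ⊛-binomial _ _ n ⟨
  (scaledBernoulli w ⊛ (λ k → 6x * G k)) n                  ≈⟨ ⊛-*ʳ 6x (scaledBernoulli w) G n ⟩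
  6x * (scaledBernoulli w ⊛ (scaledExpm1 w ⊛ pow A v)) n     ≈⟨ *-cong refl (⊛-assoc _ _ _ n) ⟩
  6x * ((scaledBernoulli w ⊛ scaledExpm1 w) ⊛ pow A v) n     ≈⟨ *-cong refl (⊛-cong (scaledBernoulli⊛scaledExpm1 w) (λ _ → refl) n) ⟩
  6x * (δ₁ ⊛ pow A v) n                                     ≈⟨ *-cong refl (δ₁⊛pow v n) ⟩
  6x * (ιℕ A n * pow A v (n ℕ.∸ 1))                         ≈⟨ *-assoc _ _ _ ⟨
  6x * ιℕ A n * pow A v (n ℕ.∸ 1)                           ≈⟨ *-cong refl (pow-double β (n ℕ.∸ 1)) ⟨
  6x * ιℕ A n * pow A β (2 ℕ.* (n ℕ.∸ 1))                   ≈⟨ reflexive (≡.cong (λ m → 6x * ιℕ A n * pow A β m) (ℕP.*-distribˡ-∸ 2 n 1)) ⟩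
  6x * ιℕ A n * pow A β (2 ℕ.* n ℕ.∸ 2)                     ≈⟨ *-cong refl (lucasBalancing-balancing≈pow-β (2 ℕ.* n ℕ.∸ 2)) ⟨
  6x * ιℕ A n * (lucasBalancing A x (2 ℕ.* n ℕ.∸ 2) - s * balancing A x (2 ℕ.* n ℕ.∸ 2)) ∎
  where
  open QAlgebra A
  open Identities A
  open Balancing x s s²≈9x²-1
  open SetoidReasoning setoid
  6x : Carrier
  6x = ιℕ A 6 * x
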